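{- In the simply-typed $\lambda$-calculus with holes, if $\Gamma,c{:}\chi\vdash r:\psi$ and $c\in\mathbb A_{\mathrm u}\setminus\mathrm{fa}(r)$, then $\Gamma\vdash r:\psi$.
   Context: Fix a countably infinite set $\mathbb A$ of atoms, partitioned into two disjoint countably infinite sets $\mathbb A=\mathbb A_{\mathrm d}\uplus\mathbb A_{\mathrm u}$, and a countably infinite set of unknowns $X,Y,Z,\dots$. Types $\phi::=\tau\mid\phi\to\phi$; constants $C$ with types $\mathrm{type}(C)$. Terms: $r::=a\mid C\mid X[b_i{:=}s_i]_{i=1}^n\mid \lambda c{:}\phi.s\mid rs$, where $\{b_1,\dots,b_n\}\subseteq\mathbb A_{\mathrm d}$ are distinct, $c\in\mathbb A_{\mathrm u}$; terms taken up to $\alpha$-equivalence (renaming of $\lambda$-bound atoms within $\mathbb A_{\mathrm u}$). Free atoms: $\mathrm{fa}(a)=\{a\}$, $\mathrm{fa}(C)=\varnothing$, $\mathrm{fa}(rs)=\mathrm{fa}(r)\cup\mathrm{fa}(s)$, $\mathrm{fa}(\lambda a{:}\phi.r)=\mathrm{fa}(r)\setminus\{a\}$, $\mathrm{fa}(X[b_i{:=}s_i]_1^n)=(\mathbb A_{\mathrm d}\setminus\{b_1,\dots,b_n\})\cup\bigcup_i\mathrm{fa}(s_i)$. A type environment $\Gamma$ is a functional set of typings $a{:}\phi$ and $X{:}\phi$; $\mathrm{dom}(\Gamma)$ the set of atoms and unknowns typed; $\Gamma,c{:}\chi$ presupposes $c\notin\mathrm{dom}(\Gamma)$. Typing rules: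 $\Gamma\vdash a:\phi$ if $a{:}\phi\in\Gamma$; $\Gamma\vdash C:\mathrm{type}(C)$; from $\Gamma,a{:}\phi\vdash r:\psi$ with $a\in\mathbb A_{\mathrm u}$ infer $\Gamma\vdash\lambda a{:}\phi.r:\phi\to\psi$; from $\Gamma\vdash r:\phi\to\psi$, $\Gamma\vdash s:\phi$ infer $\Gamma\vdash rs:\psi$; (Meta) if $X{:}\phi\in\Gamma$, $b_i{:}\psi_i\in\Gamma$ and $\Gamma\vdash s_i:\psi_i$ for $1\le i\le n$, then $\Gamma\vdash X[b_i{:=}s_i]_1^n:\phi$. -}

module Defs where

open import Data.Nat using (ℕ; zero; suc; _≡ᵇ_)
open import Data.Bool using (if_then_else_)
open import Data.List using (List; []; _∷_; map; _++_)
open import Data.List.Membership.Propositional using (_∈_)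
open import Data.List.Relation.Unary.All using (All)
open import Data.List.Relation.Unary.Unique.Propositional using (Unique)
open import Data.Product using (Σ; _×_; _,_; proj₁)
open import Relation.Nullary using (¬_)

-- Atoms: 𝔸 = 𝔸_d ⊎ 𝔸_u, each a countably infinite set (indexed by ℕ).
data Atom : Set where
  d : ℕ → Atom
  u : ℕ → Atom

Unknown : Set
Unknown = ℕ

data Ty (B : Set) : Set where
  base : B → Ty B
  _⇒_  : Ty B → Ty B → Ty B

infixr 7 _⇒_

-- Terms up to α-equivalence, in locally-nameless representation:
-- λ-bound atoms (which range over 𝔸_u) are de Bruijn indices (bvar),
-- free atoms are names (fatom).  α-equivalence classes of the paper
-- correspond to (locally closed) terms here.
-- meta X σ  is  X[b_i := s_i]_i  with σ = ((b_1 , s_1) ∷ … ∷ (b_n , s_n)),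
-- the b_i being (indices of) atoms of 𝔸_d.
data Term (B C : Set) : Set where
  bvar  : ℕ → Term B C
  fatom : Atom → Term B C
  con   : C → Term B C
  meta  : Unknown → List (ℕ × Term B C) → Term B C
  lam   : Ty B → Term B C → Term B C
  app   : Term B C → Term B C → Term B C

module _ {B C : Set} where

  mutual
    openAt : ℕ → ℕ → Term B C → Term B C
    openAt k a (bvar i)   = if i ≡ᵇ k then fatom (u a) else bvar i
    openAt k a (fatom x)  = fatom x
    openAt k a (con c)    = con c
    openAt k a (meta X σ) = meta X (openSub k a σ)
    openAt k a (lam φ t)  = lam φ (openAt (suc k) a t)
    openAt k a (app r s)  = app (openAt k a r) (openAt k a s)

    openSub : ℕ → ℕ → List (ℕ × Term B C) → List (ℕ × Term B C)
    openSub k a []            = []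
    openSub k a ((b , s) ∷ σ) = (b , openAt k a s) ∷ openSub k a σ

  open-with : Term B C → ℕ → Term B C
  open-with t a = openAt 0 a t

  -- the 𝔸_u-part of fa(r): list of n such that u n ∈ fa(r).
  -- (fa(X[b_i:=s_i]) ∩ 𝔸_u = ⋃ fa(s_i) ∩ 𝔸_u, since the b_i and
  --  𝔸_d ∖ {b_i} lie in 𝔸_d.)
  mutual
    faU : Term B C → List ℕ
    faU (bvar i)      = []
    faU (fatom (d _)) = []
    faU (fatom (u a)) = a ∷ []
    faU (con c)       = []
    faU (meta X σ)    = faUSub σ
    faU (lam φ t)     = faU t
    faU (app r s)     = faU r ++ faU s

    faUSub : List (ℕ × Term B C) → List ℕ
    faUSub []            = []
    faUSub ((b , s) ∷ σ) = faU s ++ faUSub σ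

data Key : Set where
  atm : Atom → Key
  unk : Unknown → Key

-- A type environment: a finite set of typings  k : φ  (a list; order and
-- repetition are irrelevant since only membership is used).
Ctx : Set → Set
Ctx B = List (Key × Ty B)

dom : {B : Set} → Ctx B → List Key
dom Γ = map proj₁ Γ

Functional : {B : Set} → Ctx B → Set
Functional Γ = ∀ k φ ψ → (k , φ) ∈ Γ → (k , ψ) ∈ Γ → φ ≡ ψ
  where open import Relation.Binary.PropositionalEquality using (_≡_)

-- Γ , a : φ  (the side condition a ∉ dom Γ is imposed where it is used)
_,,_∶_ : {B : Set} → Ctx B → Key → Ty B → Ctx B
Γ ,, k ∶ φ = (k , φ) ∷ Γ

-- Typing judgement  Γ ⊢ r : φ , relative to the constant typing tyC = type(·).
data _⊢[_]_∶_ {B C : Set} : Ctx B → (C → Ty B) → Term B C → Ty B → Set where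
  ⊢atom : ∀ {tyC Γ a φ} → (atm a , φ) ∈ Γ → Γ ⊢[ tyC ] fatom a ∶ φ
  ⊢con  : ∀ {tyC Γ} c → Γ ⊢[ tyC ] con c ∶ tyC c
  -- λ-rule on α-classes: choose a representative λ(u a):φ.t' whose bound
  -- atom u a is not in dom Γ; t' = open-with t a (a not free in the body).
  ⊢lam  : ∀ {tyC Γ φ ψ t} a →
          ¬ (atm (u a) ∈ dom Γ) → ¬ (a ∈ faU t) →
          (Γ ,, atm (u a) ∶ φ) ⊢[ tyC ] open-with t a ∶ ψ →
          Γ ⊢[ tyC ] lam φ t ∶ (φ ⇒ ψ)
  ⊢app  : ∀ {tyC Γ φ ψ r s} →
          Γ ⊢[ tyC ] r ∶ (φ ⇒ ψ) → Γ ⊢[ tyC ] s ∶ φ → Γ ⊢[ tyC ] app r s ∶ ψ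
  -- (Meta); the b_i are required to be distinct (as in the term syntax)
  ⊢meta : ∀ {tyC Γ X φ σ} →
          Unique (map proj₁ σ) →
          (unk X , φ) ∈ Γ →
          All (λ bs → Σ (Ty B) λ ψ →
                 ((atm (d (proj₁ bs)) , ψ) ∈ Γ) × (Γ ⊢[ tyC ] Data.Product.proj₂ bs ∶ ψ)) σ →
          Γ ⊢[ tyC ] meta X σ ∶ φ

module Submission where

-- The proof is an induction on the typing derivation, which must pass under
-- λ-binders; there the context grows on both sides.  So we generalise the
-- relation between the original context Δ and the strengthened context Δ'
-- to a "strengthening for c" (Strengthening c Δ Δ'): Δ' contains every
-- typing of Δ except possibly those of u c, dom Δ' ⊆ dom Δ, and u c ∈ dom Δ.
-- This relation is preserved by extending both contexts with the same typing,
-- and the last condition guarantees that the fresh atom chosen by a λ-rule is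
-- different from c; the freshness of c is then transported into the opened
-- body by the lemma fresh-open.  The theorem is the instance Δ = Γ , c : χ
-- and Δ' = Γ.

open import Defs
open import Data.Nat using (ℕ; suc; _≡ᵇ_)
open import Data.Bool using (true; false)
open import Data.List using (List; []; _∷_; _++_)
open import Data.List.Membership.Propositional using (_∈_; _∉_)
open import Data.List.Membership.Propositional.Properties using (∈-++⁻; ∈-++⁺ˡ; ∈-++⁺ʳ)
open import Data.List.Relation.Unary.Any using (here; there)
open import Data.List.Relation.Unary.All using (All; []; _∷_)
open import Data.Product using (Σ; _×_; _,_; proj₁; proj₂)
open import Data.Sum using ([_,_]′)
open import Data.Empty using (⊥-elim)
open import Function using (_∘_)
open import Relation.Nullary using (¬_)
open import Relation.Binary.PropositionalEquality using (_≢_; refl)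

module _ {A : Set} {x : A} where

  ∉-++⁻ˡ : ∀ {xs ys : List A} → x ∉ xs ++ ys → x ∉ xs
  ∉-++⁻ˡ x∉ = x∉ ∘ ∈-++⁺ˡ

  ∉-++⁻ʳ : ∀ (xs : List A) {ys} → x ∉ xs ++ ys → x ∉ ys
  ∉-++⁻ʳ xs x∉ = x∉ ∘ ∈-++⁺ʳ xs

  ∉-++⁺ : ∀ {xs ys : List A} → x ∉ xs → x ∉ ys → x ∉ xs ++ ys
  ∉-++⁺ {xs} x∉xs x∉ys m = [ x∉xs , x∉ys ]′ (∈-++⁻ xs m)

module _ {B C : Set} where

  -- Opening a body with an atom a ≠ c creates no free occurrence of c:
  -- the free atoms of openAt k a t are a together with those of t.
  mutual
    fresh-open : ∀ k a (t : Term B C) {c} → c ≢ a →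
                 c ∉ faU t → c ∉ faU (openAt k a t)
    fresh-open k a (bvar i)   c≢a c∉t with i ≡ᵇ k
    ... | true  = λ { (here c≡a) → c≢a c≡a }
    ... | false = c∉t
    fresh-open k a (fatom x)  c≢a c∉t = c∉t
    fresh-open k a (con _)    c≢a c∉t = c∉t
    fresh-open k a (meta X σ) c≢a c∉t = fresh-openSub k a σ c≢a c∉t
    fresh-open k a (lam φ t)  c≢a c∉t = fresh-open (suc k) a t c≢a c∉t
    fresh-open k a (app r s)  c≢a c∉t =
      ∉-++⁺ (fresh-open k a r c≢a (∉-++⁻ˡ c∉t))
            (fresh-open k a s c≢a (∉-++⁻ʳ (faU r) c∉t))

    fresh-openSub : ∀ k a (σ : List (ℕ × Term B C)) {c} → c ≢ a →
                    c ∉ faUSub σ → c ∉ faUSub (openSub k a σ)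
    fresh-openSub k a []            c≢a c∉σ = c∉σ
    fresh-openSub k a ((_ , s) ∷ σ) c≢a c∉σ =
      ∉-++⁺ (fresh-open k a s c≢a (∉-++⁻ˡ c∉σ))
            (fresh-openSub k a σ c≢a (∉-++⁻ʳ (faU s) c∉σ))

  atom-≢ : ∀ x {c} → c ∉ faU {B} {C} (fatom x) → atm x ≢ atm (u c)
  atom-≢ (d n) c∉x ()
  atom-≢ (u n) c∉x refl = c∉x (here refl)

  record Strengthening (c : ℕ) (Δ Δ' : Ctx B) : Set where
    field
      keep  : ∀ {k φ} → (k , φ) ∈ Δ → k ≢ atm (u c) → (k , φ) ∈ Δ'
      dom⊆  : ∀ {k} → k ∈ dom Δ' → k ∈ dom Δ
      c∈dom : atm (u c) ∈ dom Δ
  open Strengthening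

  drop-head : ∀ {c χ Γ} → Strengthening c (Γ ,, atm (u c) ∶ χ) Γ
  drop-head .keep (here refl) k≢c = ⊥-elim (k≢c refl)
  drop-head .keep (there m) k≢c = m
  drop-head .dom⊆ = there
  drop-head .c∈dom = here refl

  extend : ∀ {c Δ Δ'} (k : Key) (φ : Ty B) → Strengthening c Δ Δ' →
           Strengthening c (Δ ,, k ∶ φ) (Δ' ,, k ∶ φ)
  extend k φ S .keep (here e)  k≢c = here e
  extend k φ S .keep (there m) k≢c = there (keep S m k≢c)
  extend k φ S .dom⊆ (here e)  = here e
  extend k φ S .dom⊆ (there m) = there (dom⊆ S m)
  extend k φ S .c∈dom = there (c∈dom S)

  SubTyped : (C → Ty B) → Ctx B → List (ℕ × Term B C) → Set
  SubTyped tyC Δ σ = All (λ bs → Σ (Ty B) λ ψ →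
                       ((atm (d (proj₁ bs)) , ψ) ∈ Δ) × (Δ ⊢[ tyC ] proj₂ bs ∶ ψ)) σ

  mutual
    strengthen : ∀ {tyC c Δ Δ'} {r : Term B C} {ψ} → Strengthening c Δ Δ' →
                 Δ ⊢[ tyC ] r ∶ ψ → c ∉ faU r → Δ' ⊢[ tyC ] r ∶ ψ
    strengthen S (⊢atom {a = x} m) c∉r = ⊢atom (keep S m (atom-≢ x c∉r))
    strengthen S (⊢con κ) c∉r = ⊢con κ
    strengthen {c = c} S (⊢lam {φ = φ} {t = t} a a∉Δ a∉t body) c∉r =
      ⊢lam a (a∉Δ ∘ dom⊆ S) a∉t
        (strengthen (extend (atm (u a)) φ S) body (fresh-open 0 a t c≢a c∉r))
      where
        -- a is fresh for Δ while c is typed in Δ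
        c≢a : c ≢ a
        c≢a refl = a∉Δ (c∈dom S)
    strengthen S (⊢app {r = r} der₁ der₂) c∉r =
      ⊢app (strengthen S der₁ (∉-++⁻ˡ c∉r)) (strengthen S der₂ (∉-++⁻ʳ (faU r) c∉r))
    strengthen S (⊢meta uniq m σ-typed) c∉σ =
      ⊢meta uniq (keep S m (λ ())) (strengthenSub S σ-typed c∉σ)

    strengthenSub : ∀ {tyC c Δ Δ'} {σ : List (ℕ × Term B C)} → Strengthening c Δ Δ' →
                    SubTyped tyC Δ σ → c ∉ faUSub σ → SubTyped tyC Δ' σ
    strengthenSub S [] c∉σ = []
    strengthenSub {σ = (_ , s) ∷ σ} S ((ψ , m , der) ∷ σ-typed) c∉σ =
      (ψ , keep S m (λ ()) , strengthen S der (∉-++⁻ˡ c∉σ))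
      ∷ strengthenSub S σ-typed (∉-++⁻ʳ (faU s) c∉σ)

-- Lemma 4.15.
lemma4p15 : {B C : Set} (tyC : C → Ty B) (Γ : Ctx B) (c : ℕ) (χ ψ : Ty B)
            (r : Term B C) →
            Functional Γ → ¬ (atm (u c) ∈ dom Γ) →
            (Γ ,, atm (u c) ∶ χ) ⊢[ tyC ] r ∶ ψ →
            ¬ (c ∈ faU r) →
            Γ ⊢[ tyC ] r ∶ ψ
lemma4p15 tyC Γ c χ ψ r _ _ der c∉r = strengthen drop-head der c∉r
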